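{- Let $p\ge q\ge1$ be integers and let $B=(b_1<\dots<b_p)$ be a $p$-element subset of $[p+q]$ with complement $\bar B=(\bar b_1<\dots<\bar b_q)$, such that $B$ and $\bar B$ are incomparable in the order $\prec$; let $d\le q$ be an index with $b_d>\bar b_d$. Put $B^{\rm left}=\{b_1,\dots,b_{d-1}\}$, $C=\{\bar b_1,\dots,\bar b_d\}\cup\{b_d,\dots,b_p\}$, and $$\mathcal B=\{B^{\rm left}\cup Z: Z\subset C,\ |Z|=p-d+1\}.$$ Let $\mathcal A=\{A\in\mathcal B:\Sigma(A)\text{ odd}\}$ and $\mathcal A'=\{A\in\mathcal B:\Sigma(A)\text{ even}\}$, where $\Sigma(A)=\sum_{i\in A}i$. Then the pair $\mathcal A,\mathcal A'$ is balanced.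
   Context: For subsets $A=(a_1<\dots<a_r)$ and $D=(d_1<\dots<d_s)$ of $[n]$, $A\prec D$ means $r\ge s$ and $a_i\le d_i$ for $i=1,\dots,s$. $[i..j]=\{i,\dots,j\}$. For a $p$-element $A\subseteq[p+q]$, a feasible matching for $A$ is a set $M$ of $q$ pairwise disjoint arcs $(i,j)$, $i<j$, in $[p+q]$, each with exactly one end in $A$, such that for any two arcs the intervals $[i..j]$, $[i'..j']$ are disjoint or nested, and every element lying in the interval of some arc is an endpoint of some arc of $M$. $\mathcal M(A)$ is the set of feasible matchings for $A$. Collections $\mathcal A,\mathcal A'$ of $p$-subsets of $[p+q]$ are balanced if for every arc set $M$, $|\{A\in\mathcal A: M\in\mathcal M(A)\}|=|\{A'\in\mathcal A':M\in\mathcal M(A')\}|$. -}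

module Defs where

open import Data.Nat as ℕ using (ℕ; zero; suc; _+_; _∸_)
open import Data.Nat.Properties as ℕP using ()
open import Data.Bool using (Bool; true; false; if_then_else_)
import Data.Bool.Properties as BoolP
open import Data.Fin as Fin using (Fin; toℕ)
import Data.Fin.Properties as FinP
open import Data.Fin.Subset using (Subset; inside; outside; _∈_; _∉_; _⊆_; _∪_; ∣_∣; ∁)
open import Data.Fin.Subset.Properties using (_∈?_; _⊆?_; anySubset?)
open import Data.Vec using (Vec; []; _∷_; tabulate)
import Data.Vec.Properties as VecP
open import Data.List as List using (List; []; _∷_; length; take; drop; filter; _++_)
open import Data.Nat.ListAction using (sum)
open import Data.List.Relation.Unary.All as All using (All)
open import Data.List.Relation.Unary.Any as Any using (Any)
open import Data.List.Relation.Unary.AllPairs using (AllPairs; allPairs?)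
open import Data.List.Relation.Binary.Pointwise using (Pointwise)
import Data.List.Membership.DecPropositional as DecMem
open import Data.Product using (Σ; _×_; _,_; ∃)
open import Data.Product.Properties using ()
open import Data.Sum using (_⊎_)
open import Relation.Nullary using (¬_; Dec; yes; no; does)
open import Relation.Nullary.Decidable using (_×-dec_; _⊎-dec_; ¬?)
open import Relation.Unary using (Pred; Decidable)
open import Relation.Binary.PropositionalEquality using (_≡_)
open import Level using (0ℓ)

-- Conventions.  A subset of [n] = {1,…,n} is a 'Subset n'; the position
-- i : Fin n stands for the element  toℕ i + 1  of [n].

elems : ∀ {n} → Subset n → List ℕ
elems []            = []
elems (true  ∷ s)   = 1 ∷ List.map suc (elems s)
elems (false ∷ s)   = List.map suc (elems s)

fromList : ∀ {n} → List ℕ → Subset n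
fromList xs = tabulate (λ i → does (suc (toℕ i) ∈ℕ? xs))
  where open DecMem ℕ._≟_ renaming (_∈?_ to _∈ℕ?_)

-- d-th element (1-indexed) of a list; 0 if out of range (never used so).
nth : List ℕ → ℕ → ℕ
nth []       _             = 0
nth (x ∷ xs) zero          = 0
nth (x ∷ xs) (suc zero)    = x
nth (x ∷ xs) (suc (suc k)) = nth xs (suc k)

Σ[_] : ∀ {n} → Subset n → ℕ
Σ[ A ] = sum (elems A)

_≺_ : List ℕ → List ℕ → Set
A ≺ D = length D ℕ.≤ length A × Pointwise ℕ._≤_ (take (length D) A) D

Arc : ℕ → Set
Arc n = Fin n × Fin n

compatible : ∀ {n} → Arc n → Arc n → Set
compatible (i , j) (i′ , j′) =
  (¬ i ≡ i′ × ¬ i ≡ j′ × ¬ j ≡ i′ × ¬ j ≡ j′) ×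
  ((j Fin.< i′ ⊎ j′ Fin.< i) ⊎ ((i Fin.≤ i′ × j′ Fin.≤ j) ⊎ (i′ Fin.≤ i × j Fin.≤ j′)))

oneEndIn : ∀ {n} → Subset n → Arc n → Set
oneEndIn A (i , j) = (i ∈ A × j ∉ A) ⊎ (i ∉ A × j ∈ A)

isArc : ∀ {n} → Arc n → Set
isArc (i , j) = i Fin.< j

inInterval : ∀ {n} → Fin n → Arc n → Set
inInterval k (i , j) = i Fin.≤ k × k Fin.≤ j

isEndpoint : ∀ {n} → Fin n → Arc n → Set
isEndpoint k (i , j) = k ≡ i ⊎ k ≡ j

Feasible : (p q : ℕ) → Subset (p + q) → List (Arc (p + q)) → Set
Feasible p q A M =
  length M ≡ q ×
  All isArc M ×
  AllPairs compatible M ×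
  All (oneEndIn A) M ×
  (∀ k → Any (inInterval k) M → Any (isEndpoint k) M)

feasible? : (p q : ℕ) → (A : Subset (p + q)) → (M : List (Arc (p + q))) → Dec (Feasible p q A M)
feasible? p q A M =
  (length M ℕ.≟ q) ×-dec
  All.all? (λ { (i , j) → i Fin.<? j }) M ×-dec
  allPairs? compat? M ×-dec
  All.all? one? M ×-dec
  FinP.all? (λ k → Any.any? (λ { (i , j) → (i Fin.≤? k) ×-dec (k Fin.≤? j) }) M
                     →-dec Any.any? (λ { (i , j) → (k FinP.≟ i) ⊎-dec (k FinP.≟ j) }) M)
  where
  _→-dec_ : ∀ {P Q : Set} → Dec P → Dec Q → Dec (P → Q)
  _→-dec_ = Relation.Nullary.Decidable._→-dec_
  compat? : (a b : Arc (p + q)) → Dec (compatible a b)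
  compat? (i , j) (i′ , j′) =
    (¬? (i FinP.≟ i′) ×-dec ¬? (i FinP.≟ j′) ×-dec ¬? (j FinP.≟ i′) ×-dec ¬? (j FinP.≟ j′)) ×-dec
    (((j Fin.<? i′) ⊎-dec (j′ Fin.<? i)) ⊎-dec
     (((i Fin.≤? i′) ×-dec (j′ Fin.≤? j)) ⊎-dec ((i′ Fin.≤? i) ×-dec (j Fin.≤? j′))))
  one? : (a : Arc (p + q)) → Dec (oneEndIn A a)
  one? (i , j) = ((i ∈? A) ×-dec ¬? (j ∈? A)) ⊎-dec (¬? (i ∈? A) ×-dec (j ∈? A))

allSubsets : ∀ n → List (Subset n)
allSubsets zero    = [] ∷ []
allSubsets (suc n) = List.map (inside ∷_) (allSubsets n) ++ List.map (outside ∷_) (allSubsets n)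

countFeasible : (p q : ℕ) {𝒜 : Pred (Subset (p + q)) 0ℓ} → Decidable 𝒜 →
                List (Arc (p + q)) → ℕ
countFeasible p q 𝒜? M =
  length (filter (λ A → 𝒜? A ×-dec feasible? p q A M) (allSubsets (p + q)))

Balanced : (p q : ℕ) {𝒜 𝒜′ : Pred (Subset (p + q)) 0ℓ} → Decidable 𝒜 → Decidable 𝒜′ → Set
Balanced p q 𝒜? 𝒜′? = ∀ (M : List (Arc (p + q))) → countFeasible p q 𝒜? M ≡ countFeasible p q 𝒜′? M

Bleft : ∀ {n} → Subset n → ℕ → Subset n
Bleft B d = fromList (take (d ∸ 1) (elems B))

Cset : ∀ {n} → Subset n → ℕ → Subset n
Cset B d = fromList (take d (elems (∁ B)) ++ drop (d ∸ 1) (elems B))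

inℬ : (p : ℕ) → ∀ {n} → Subset n → ℕ → Subset n → Set
inℬ p B d A = ∃ λ Z → Z ⊆ Cset B d × ∣ Z ∣ ≡ p ∸ d + 1 × A ≡ Bleft B d ∪ Z

inℬ? : (p : ℕ) → ∀ {n} → (B : Subset n) → (d : ℕ) → Decidable (inℬ p B d)
inℬ? p B d A = anySubset? (λ Z → (Z ⊆? Cset B d) ×-dec (∣ Z ∣ ℕ.≟ p ∸ d + 1)
                                 ×-dec VecP.≡-dec BoolP._≟_ A (Bleft B d ∪ Z))

Odd Even : ℕ → Set
Odd  m = m ℕ.% 2 ≡ 1
Even m = m ℕ.% 2 ≡ 0

𝒜odd : (p : ℕ) → ∀ {n} → Subset n → ℕ → Pred (Subset n) 0ℓ
𝒜odd p B d A = inℬ p B d A × Odd Σ[ A ]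

𝒜even : (p : ℕ) → ∀ {n} → Subset n → ℕ → Pred (Subset n) 0ℓ
𝒜even p B d A = inℬ p B d A × Even Σ[ A ]

𝒜odd? : (p : ℕ) → ∀ {n} → (B : Subset n) → (d : ℕ) → Decidable (𝒜odd p B d)
𝒜odd? p B d A = inℬ? p B d A ×-dec (Σ[ A ] ℕ.% 2 ℕ.≟ 1)

𝒜even? : (p : ℕ) → ∀ {n} → (B : Subset n) → (d : ℕ) → Decidable (𝒜even p B d)
𝒜even? p B d A = inℬ? p B d A ×-dec (Σ[ A ] ℕ.% 2 ℕ.≟ 0)

module Submission where

-- Let n = p + q and call the points b_1,…,b_{d-1}, b̄_{d+1},…,b̄_q of [n]
-- blocked: there are fewer than q of them, and they include B^left and every
-- point outside C.  Fix an arc set M.  If every arc of M has a blocked endpoint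
-- then, the arcs having disjoint endpoints, M has fewer than q arcs and no A
-- admits M.  Otherwise some arc (u , v) ∈ M has u, v ∈ C ∖ B^left, and the
-- involution A ↦ A △ {u , v} maps members of ℬ admitting M to members of ℬ
-- admitting M (it trades u for v inside Z ⊆ C, and only the arc (u , v) sees the
-- change) while changing Σ(A) by ±(v − u), which is odd because the nested arcs
-- of M pair off the points of [u..v].  Hence the two counts agree.

open import Defs
open import Data.Nat as ℕ using (ℕ; zero; suc; _+_; _*_; _∸_; _≤_; _<_; z≤n; s≤s)
import Data.Nat.Properties as ℕP
open import Data.Nat.DivMod using ([m+kn]%n≡m%n)
open import Data.Nat.ListAction using (sum)
open import Data.Nat.Tactic.RingSolver using (solve-∀)
open import Data.Bool using (Bool; true; false; not; _∨_)
open import Data.Bool.Properties using (not-involutive)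
open import Data.Fin as Fin using (Fin; toℕ; zero; suc)
import Data.Fin.Properties as FinP
open import Data.Fin.Subset using (Subset; inside; outside; _∈_; _∉_; _⊆_; _∪_; ∣_∣; ∁)
import Data.Fin.Subset.Properties as SubsetP
open import Data.Vec.Base using ([]; _∷_; here; there)
import Data.Vec.Properties as VecP
open import Data.List as List using (List; []; _∷_; length; map; filter; take; drop; _++_)
import Data.List.Properties as ListP
open import Data.List.Membership.Propositional using (find) renaming (_∈_ to _∈ₗ_)
open import Data.List.Membership.Propositional.Properties using (∈-map⁺; ∈-map⁻; ∈-++⁻; ∈-++⁺ˡ; ∈-++⁺ʳ)
open import Data.List.Membership.DecPropositional ℕ._≟_ using () renaming (_∈?_ to _∈ₗ?_)
open import Data.List.Relation.Unary.All as All using (All; []; _∷_)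
open import Data.List.Relation.Unary.All.Properties using (¬All⇒Any¬)
open import Data.List.Relation.Unary.Any as Any using (Any; here; there)
open import Data.List.Relation.Unary.AllPairs using (AllPairs; []; _∷_)
open import Data.Product as Product using (_×_; _,_; ∃; proj₁; proj₂)
open import Data.Sum as Sum using (_⊎_; inj₁; inj₂; [_,_])
open import Data.Empty using (⊥-elim)
open import Function using (_∘_; _⇔_; mk⇔; Equivalence)
import Function.Properties.Equivalence as ⇔
open import Level using (0ℓ)
open import Relation.Nullary using (¬_; Dec; yes; no; does)
open import Relation.Nullary.Decidable using (_×-dec_; _⊎-dec_; dec-true; decidable-stable)
open import Relation.Unary using (Pred; Decidable)
open import Relation.Binary.PropositionalEquality
  using (_≡_; _≢_; refl; sym; trans; cong; cong₂; subst; module ≡-Reasoning)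

toggle : ∀ {n} → Fin n → Subset n → Subset n
toggle zero    (b ∷ s) = not b ∷ s
toggle (suc x) (b ∷ s) = b ∷ toggle x s

toggle-∈ : ∀ {n} {x : Fin n} {S} → x ∈ S → x ∉ toggle x S
toggle-∈ here      ()
toggle-∈ (there p) (there q) = toggle-∈ p q

toggle-∉ : ∀ {n} {x : Fin n} {S} → x ∉ S → x ∈ toggle x S
toggle-∉ {x = zero}  {false ∷ s} _  = here
toggle-∉ {x = zero}  {true  ∷ s} x∉ = ⊥-elim (x∉ here)
toggle-∉ {x = suc x} {b ∷ s}     x∉ = there (toggle-∉ (x∉ ∘ there))

toggle-≢ : ∀ {n} {x y : Fin n} {S} → y ≢ x → y ∈ toggle x S ⇔ y ∈ S
toggle-≢ y≢x = mk⇔ (from y≢x) (to y≢x)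
  where
  to : ∀ {n} {x y : Fin n} {S} → y ≢ x → y ∈ S → y ∈ toggle x S
  to {x = zero}  y≢x here      = ⊥-elim (y≢x refl)
  to {x = zero}  y≢x (there p) = there p
  to {x = suc x} y≢x here      = here
  to {x = suc x} y≢x (there p) = there (to (y≢x ∘ cong suc) p)
  from : ∀ {n} {x y : Fin n} {S} → y ≢ x → y ∈ toggle x S → y ∈ S
  from {x = zero}  {zero}          y≢x _         = ⊥-elim (y≢x refl)
  from {x = zero}  {suc y} {b ∷ s} y≢x (there p) = there p
  from {x = suc x} {zero}  {b ∷ s} y≢x here      = here
  from {x = suc x} {suc y} {b ∷ s} y≢x (there p) = there (from (y≢x ∘ cong suc) p)

toggle-involutive : ∀ {n} (x : Fin n) S → toggle x (toggle x S) ≡ S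
toggle-involutive zero    (b ∷ s) = cong (_∷ s) (not-involutive b)
toggle-involutive (suc x) (b ∷ s) = cong (b ∷_) (toggle-involutive x s)

toggle-comm : ∀ {n} (x y : Fin n) S → toggle x (toggle y S) ≡ toggle y (toggle x S)
toggle-comm zero    zero    (b ∷ s) = refl
toggle-comm zero    (suc y) (b ∷ s) = refl
toggle-comm (suc x) zero    (b ∷ s) = refl
toggle-comm (suc x) (suc y) (b ∷ s) = cong (b ∷_) (toggle-comm x y s)

toggle-∪ : ∀ {n} (x : Fin n) (X Y : Subset n) → x ∉ X → toggle x (X ∪ Y) ≡ X ∪ toggle x Y
toggle-∪ zero    (true  ∷ X) (b ∷ Y) x∉X = ⊥-elim (x∉X here)
toggle-∪ zero    (false ∷ X) (b ∷ Y) x∉X = refl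
toggle-∪ (suc x) (a ∷ X)     (b ∷ Y) x∉X = cong ((a ∨ b) ∷_) (toggle-∪ x X Y (x∉X ∘ there))

∣toggle∣-∈ : ∀ {n} {x : Fin n} {S} → x ∈ S → suc ∣ toggle x S ∣ ≡ ∣ S ∣
∣toggle∣-∈ here                        = refl
∣toggle∣-∈ {S = true  ∷ s} (there x∈s) = cong suc (∣toggle∣-∈ x∈s)
∣toggle∣-∈ {S = false ∷ s} (there x∈s) = ∣toggle∣-∈ x∈s

∣toggle∣-∉ : ∀ {n} {x : Fin n} {S} → x ∉ S → ∣ toggle x S ∣ ≡ suc ∣ S ∣
∣toggle∣-∉ {x = x} {S} x∉S =
  sym (subst (λ T → suc ∣ T ∣ ≡ ∣ toggle x S ∣) (toggle-involutive x S)
             (∣toggle∣-∈ (toggle-∉ x∉S)))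

∣∪∣≤ : ∀ {n} (S T : Subset n) → ∣ S ∪ T ∣ ≤ ∣ S ∣ + ∣ T ∣
∣∪∣≤ []          []          = z≤n
∣∪∣≤ (true  ∷ S) (true  ∷ T) =
  s≤s (ℕP.≤-trans (∣∪∣≤ S T) (ℕP.+-monoʳ-≤ ∣ S ∣ (ℕP.n≤1+n ∣ T ∣)))
∣∪∣≤ (true  ∷ S) (false ∷ T) = s≤s (∣∪∣≤ S T)
∣∪∣≤ (false ∷ S) (true  ∷ T) =
  ℕP.≤-trans (s≤s (∣∪∣≤ S T)) (ℕP.≤-reflexive (sym (ℕP.+-suc ∣ S ∣ ∣ T ∣)))
∣∪∣≤ (false ∷ S) (false ∷ T) = ∣∪∣≤ S T

length-elems : ∀ {n} (S : Subset n) → length (elems S) ≡ ∣ S ∣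
length-elems []          = refl
length-elems (true  ∷ s) = cong suc (trans (ListP.length-map suc (elems s)) (length-elems s))
length-elems (false ∷ s) = trans (ListP.length-map suc (elems s)) (length-elems s)

sum-map-suc : ∀ xs → sum (map suc xs) ≡ sum xs + length xs
sum-map-suc []       = refl
sum-map-suc (x ∷ xs) = trans (cong (suc x +_) (sum-map-suc xs)) (shuffle x (sum xs) (length xs))
  where shuffle : ∀ a b c → suc a + (b + c) ≡ a + b + suc c
        shuffle = solve-∀

Σ-shift : ∀ {n} (s : Subset n) → sum (map suc (elems s)) ≡ Σ[ s ] + ∣ s ∣
Σ-shift s = trans (sum-map-suc (elems s)) (cong (Σ[ s ] +_) (length-elems s))

bit : Bool → ℕ
bit true  = 1
bit false = 0

Σ-cons : ∀ {n} b (s : Subset n) → Σ[ b ∷ s ] ≡ bit b + (Σ[ s ] + ∣ s ∣)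
Σ-cons true  s = cong suc (Σ-shift s)
Σ-cons false s = Σ-shift s

Σ-toggle-∈ : ∀ {n} {x : Fin n} {S} → x ∈ S → Σ[ toggle x S ] + suc (toℕ x) ≡ Σ[ S ]
Σ-toggle-∈ {S = true ∷ s} here = ℕP.+-comm Σ[ false ∷ s ] 1
Σ-toggle-∈ {x = suc x} {S = b ∷ s} (there x∈s) = begin
  Σ[ b ∷ t ] + suc (suc (toℕ x))                ≡⟨ cong (_+ suc (suc (toℕ x))) (Σ-cons b t) ⟩
  bit b + (Σ[ t ] + ∣ t ∣) + suc (suc (toℕ x))  ≡⟨ shuffle (bit b) Σ[ t ] ∣ t ∣ (toℕ x) ⟩
  bit b + ((Σ[ t ] + suc (toℕ x)) + suc ∣ t ∣)
    ≡⟨ cong₂ (λ a c → bit b + (a + c)) (Σ-toggle-∈ x∈s) (∣toggle∣-∈ x∈s) ⟩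
  bit b + (Σ[ s ] + ∣ s ∣)                      ≡⟨ Σ-cons b s ⟨
  Σ[ b ∷ s ]                                    ∎
  where
  open ≡-Reasoning
  t = toggle x s
  shuffle : ∀ a c e m → a + (c + e) + suc (suc m) ≡ a + ((c + suc m) + suc e)
  shuffle = solve-∀

Σ-toggle-∉ : ∀ {n} {x : Fin n} {S} → x ∉ S → Σ[ toggle x S ] ≡ Σ[ S ] + suc (toℕ x)
Σ-toggle-∉ {x = x} {S} x∉S =
  sym (subst (λ T → Σ[ T ] + suc (toℕ x) ≡ Σ[ toggle x S ]) (toggle-involutive x S)
             (Σ-toggle-∈ (toggle-∉ x∉S)))

exchange : ∀ {n} → Fin n → Fin n → Subset n → Subset n
exchange x y S = toggle x (toggle y S)

exchange-comm : ∀ {n} (x y : Fin n) S → exchange x y S ≡ exchange y x S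
exchange-comm = toggle-comm

exchange-involutive : ∀ {n} (x y : Fin n) S → exchange x y (exchange x y S) ≡ S
exchange-involutive x y S = begin
  toggle x (toggle y (toggle x (toggle y S)))  ≡⟨ cong (toggle x) (toggle-comm y x (toggle y S)) ⟩
  toggle x (toggle x (toggle y (toggle y S)))  ≡⟨ toggle-involutive x (toggle y (toggle y S)) ⟩
  toggle y (toggle y S)                        ≡⟨ toggle-involutive y S ⟩
  S                                            ∎
  where open ≡-Reasoning

exchange-≢ : ∀ {n} {x y k : Fin n} {S} → k ≢ x → k ≢ y → k ∈ exchange x y S ⇔ k ∈ S
exchange-≢ k≢x k≢y = ⇔.trans (toggle-≢ k≢x) (toggle-≢ k≢y)

module Trade {n} {x y : Fin n} {S : Subset n} (x∈S : x ∈ S) (y∉S : y ∉ S) where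

  private
    x≢y : x ≢ y
    x≢y refl = y∉S x∈S

    x∈toggle-y : x ∈ toggle y S
    x∈toggle-y = Equivalence.from (toggle-≢ x≢y) x∈S

  traded-out : x ∉ exchange x y S
  traded-out = toggle-∈ x∈toggle-y

  traded-in : y ∈ exchange x y S
  traded-in = Equivalence.from (toggle-≢ (x≢y ∘ sym)) (toggle-∉ y∉S)

  ∣traded∣ : ∣ exchange x y S ∣ ≡ ∣ S ∣
  ∣traded∣ = ℕP.suc-injective (trans (∣toggle∣-∈ x∈toggle-y) (∣toggle∣-∉ y∉S))

  Σ-traded : Σ[ exchange x y S ] + suc (toℕ x) ≡ Σ[ S ] + suc (toℕ y)
  Σ-traded = trans (Σ-toggle-∈ x∈toggle-y) (Σ-toggle-∉ y∉S)

exchange-oneEndIn : ∀ {n} {x y : Fin n} {S} → oneEndIn S (x , y) → oneEndIn (exchange x y S) (x , y)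
exchange-oneEndIn (inj₁ (x∈ , y∉)) = inj₂ (Trade.traded-out x∈ y∉ , Trade.traded-in x∈ y∉)
exchange-oneEndIn {x = x} {y} {S} (inj₂ (x∉ , y∈)) =
  subst (λ T → oneEndIn T (x , y)) (exchange-comm y x S) (inj₁ (Trade.traded-in y∈ x∉ , Trade.traded-out y∈ x∉))

∣exchange∣ : ∀ {n} {x y : Fin n} {S} → oneEndIn S (x , y) → ∣ exchange x y S ∣ ≡ ∣ S ∣
∣exchange∣ (inj₁ (x∈ , y∉)) = Trade.∣traded∣ x∈ y∉
∣exchange∣ {x = x} {y} {S} (inj₂ (x∉ , y∈)) =
  trans (cong ∣_∣ (exchange-comm x y S)) (Trade.∣traded∣ y∈ x∉)

OppositeParity : ℕ → ℕ → Set
OppositeParity a b = (Odd a ⇔ Even b) × (Even a ⇔ Odd b)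

opposite-sym : ∀ a b → OppositeParity a b → OppositeParity b a
opposite-sym _ _ (odd⇔even , even⇔odd) = ⇔.sym even⇔odd , ⇔.sym odd⇔even

opposite-suc : ∀ b → OppositeParity (suc b) b
opposite-suc zero          = mk⇔ (λ _ → refl) (λ _ → refl) , mk⇔ (λ ()) (λ ())
opposite-suc (suc zero)    = mk⇔ (λ ()) (λ ()) , mk⇔ (λ _ → refl) (λ _ → refl)
opposite-suc (suc (suc b)) = opposite-suc b

opposite-odd-gap : ∀ a b m → a ≡ b + suc (m * 2) → OppositeParity a b
opposite-odd-gap a b m a≡ =
  subst (λ r → (r ≡ 1 ⇔ Even b) × (r ≡ 0 ⇔ Odd b)) (sym a%2) (opposite-suc b)
  where
  a%2 : a ℕ.% 2 ≡ suc b ℕ.% 2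
  a%2 = trans (cong (ℕ._% 2) (trans a≡ (ℕP.+-suc b (m * 2)))) ([m+kn]%n≡m%n (suc b) m 2)

odd-gap : ∀ {a b x y} m → y ≡ x + suc (m * 2) → a + suc x ≡ b + suc y → OppositeParity a b
odd-gap {a} {b} {x} m refl e =
  opposite-odd-gap a b m (ℕP.+-cancelʳ-≡ (suc x) a _ (trans e (shuffle b x (m * 2))))
  where shuffle : ∀ s a c → s + suc (a + suc c) ≡ s + suc c + suc a
        shuffle = solve-∀

exchange-parity : ∀ {n} {x y : Fin n} {S} m → toℕ y ≡ toℕ x + suc (m * 2) → oneEndIn S (x , y) →
                  OppositeParity Σ[ exchange x y S ] Σ[ S ]
exchange-parity m y≡ (inj₁ (x∈ , y∉)) = odd-gap m y≡ (Trade.Σ-traded x∈ y∉)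
exchange-parity {x = x} {y} {S} m y≡ (inj₂ (x∉ , y∈)) =
  opposite-sym Σ[ S ] Σ[ exchange x y S ]
    (odd-gap m y≡ (trans (sym (Trade.Σ-traded y∈ x∉))
                         (cong (λ T → Σ[ T ] + suc (toℕ y)) (exchange-comm y x S))))

count : ∀ {n} {P : Pred (Subset n) 0ℓ} → Decidable P → ℕ
count {n} P? = length (filter P? (allSubsets n))

count-cong : ∀ {n} {P Q : Pred (Subset n) 0ℓ} (P? : Decidable P) (Q? : Decidable Q) →
             (∀ A → P A → Q A) → (∀ A → Q A → P A) → count P? ≡ count Q?
count-cong {n} P? Q? P⇒Q Q⇒P =
  cong length (ListP.filter-≐ P? Q? ((λ {A} → P⇒Q A) , (λ {A} → Q⇒P A)) (allSubsets n))

count-none : ∀ {n} {P : Pred (Subset n) 0ℓ} (P? : Decidable P) → (∀ A → ¬ P A) → count P? ≡ 0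
count-none {n} P? none =
  cong length (ListP.filter-none P? {allSubsets n} (All.tabulate (λ {A} _ → none A)))

length-filter-map : ∀ {A B : Set} {P : Pred B 0ℓ} (P? : Decidable P) (f : A → B) xs →
                    length (filter P? (map f xs)) ≡ length (filter (P? ∘ f) xs)
length-filter-map P? f []       = refl
length-filter-map P? f (x ∷ xs) with does (P? (f x))
... | true  = cong suc (length-filter-map P? f xs)
... | false = length-filter-map P? f xs

count-split : ∀ {n} {P : Pred (Subset (suc n)) 0ℓ} (P? : Decidable P) →
              count P? ≡ count (P? ∘ (inside ∷_)) + count (P? ∘ (outside ∷_))
count-split {n} P? = begin
  length (filter P? (map (inside ∷_) all ++ map (outside ∷_) all))
    ≡⟨ cong length (ListP.filter-++ P? (map (inside ∷_) all) (map (outside ∷_) all)) ⟩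
  length (filter P? (map (inside ∷_) all) ++ filter P? (map (outside ∷_) all))
    ≡⟨ ListP.length-++ (filter P? (map (inside ∷_) all)) ⟩
  length (filter P? (map (inside ∷_) all)) + length (filter P? (map (outside ∷_) all))
    ≡⟨ cong₂ _+_ (length-filter-map P? (inside ∷_) all) (length-filter-map P? (outside ∷_) all) ⟩
  count (P? ∘ (inside ∷_)) + count (P? ∘ (outside ∷_)) ∎
  where
  open ≡-Reasoning
  all : List (Subset n)
  all = allSubsets n

-- Toggling a fixed element is a bijection of the power set, so it preserves counts.
count-toggle : ∀ {n} {P : Pred (Subset n) 0ℓ} (P? : Decidable P) (x : Fin n) →
               count (P? ∘ toggle x) ≡ count P?
count-toggle P? zero = begin
  count (P? ∘ toggle zero)
    ≡⟨ count-split (P? ∘ toggle zero) ⟩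
  count (P? ∘ (outside ∷_)) + count (P? ∘ (inside ∷_))
    ≡⟨ ℕP.+-comm (count (P? ∘ (outside ∷_))) _ ⟩
  count (P? ∘ (inside ∷_)) + count (P? ∘ (outside ∷_))
    ≡⟨ count-split P? ⟨
  count P? ∎
  where open ≡-Reasoning
count-toggle P? (suc x) = begin
  count (P? ∘ toggle (suc x))
    ≡⟨ count-split (P? ∘ toggle (suc x)) ⟩
  count (P? ∘ (inside ∷_) ∘ toggle x) + count (P? ∘ (outside ∷_) ∘ toggle x)
    ≡⟨ cong₂ _+_ (count-toggle (P? ∘ (inside ∷_)) x) (count-toggle (P? ∘ (outside ∷_)) x) ⟩
  count (P? ∘ (inside ∷_)) + count (P? ∘ (outside ∷_))
    ≡⟨ count-split P? ⟨
  count P? ∎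
  where open ≡-Reasoning

count-exchange : ∀ {n} {P Q : Pred (Subset n) 0ℓ} (P? : Decidable P) (Q? : Decidable Q) (x y : Fin n) →
                 (∀ A → P A → Q (exchange x y A)) → (∀ A → Q A → P (exchange x y A)) →
                 count P? ≡ count Q?
count-exchange {P = P} {Q} P? Q? x y P⇒Q Q⇒P = begin
  count P?                           ≡⟨ count-cong P? (Q? ∘ exchange x y) P⇒Q back ⟩
  count (Q? ∘ toggle x ∘ toggle y)   ≡⟨ count-toggle (Q? ∘ toggle x) y ⟩
  count (Q? ∘ toggle x)              ≡⟨ count-toggle Q? x ⟩
  count Q?                           ∎
  where
  open ≡-Reasoning
  back : ∀ A → Q (exchange x y A) → P A
  back A q = subst P (exchange-involutive x y A) (Q⇒P _ q)

0∉elems : ∀ {n} (S : Subset n) → ¬ (0 ∈ₗ elems S)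
0∉elems []          ()
0∉elems (true  ∷ s) (there 0∈) with ∈-map⁻ suc 0∈
... | _ , _ , ()
0∉elems (false ∷ s) 0∈ with ∈-map⁻ suc 0∈
... | _ , _ , ()

∈⇔∈elems : ∀ {n} {x : Fin n} {S} → x ∈ S ⇔ suc (toℕ x) ∈ₗ elems S
∈⇔∈elems = mk⇔ to from
  where
  map-suc⁻ : ∀ {a} xs → suc a ∈ₗ map suc xs → a ∈ₗ xs
  map-suc⁻ xs m with ∈-map⁻ suc m
  ... | _ , a∈ , refl = a∈
  to : ∀ {n} {x : Fin n} {S} → x ∈ S → suc (toℕ x) ∈ₗ elems S
  to here                          = here refl
  to {S = true  ∷ s} (there x∈s) = there (∈-map⁺ suc (to x∈s))
  to {S = false ∷ s} (there x∈s) = ∈-map⁺ suc (to x∈s)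
  from : ∀ {n} {x : Fin n} {S} → suc (toℕ x) ∈ₗ elems S → x ∈ S
  from {x = zero}  {true  ∷ s} _           = here
  from {x = suc x} {true  ∷ s} (there m)   = there (from (map-suc⁻ (elems s) m))
  from {x = zero}  {false ∷ s} m           = ⊥-elim (0∉elems s (map-suc⁻ (elems s) m))
  from {x = suc x} {false ∷ s} m           = there (from (map-suc⁻ (elems s) m))

∈⇔∈fromList : ∀ {n} {x : Fin n} L → x ∈ fromList {n} L ⇔ suc (toℕ x) ∈ₗ L
∈⇔∈fromList {x = x} L = mk⇔
  (λ x∈ → accepted (suc (toℕ x) ∈ₗ? L) (trans (sym (VecP.lookup∘tabulate _ x)) (VecP.[]=⇒lookup x∈)))
  (λ m → VecP.lookup⇒[]= x _ (trans (VecP.lookup∘tabulate _ x) (dec-true (suc (toℕ x) ∈ₗ? L) m)))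
  where
  accepted : ∀ {A : Set} (a? : Dec A) → does a? ≡ true → A
  accepted (yes a) _ = a

takeˢ : ∀ {n} → Subset n → ℕ → Subset n
takeˢ []          k       = []
takeˢ (false ∷ s) k       = outside ∷ takeˢ s k
takeˢ (true  ∷ s) zero    = outside ∷ takeˢ s zero
takeˢ (true  ∷ s) (suc k) = inside  ∷ takeˢ s k

dropˢ : ∀ {n} → Subset n → ℕ → Subset n
dropˢ []          k       = []
dropˢ (false ∷ s) k       = outside ∷ dropˢ s k
dropˢ (true  ∷ s) zero    = inside  ∷ dropˢ s zero
dropˢ (true  ∷ s) (suc k) = outside ∷ dropˢ s k

elems-takeˢ : ∀ {n} (S : Subset n) k → elems (takeˢ S k) ≡ take k (elems S)
elems-takeˢ []          zero    = refl
elems-takeˢ []          (suc k) = refl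
elems-takeˢ (false ∷ s) k       = trans (cong (map suc) (elems-takeˢ s k)) (sym (ListP.take-map k (elems s)))
elems-takeˢ (true  ∷ s) zero    = cong (map suc) (elems-takeˢ s zero)
elems-takeˢ (true  ∷ s) (suc k) =
  cong (1 ∷_) (trans (cong (map suc) (elems-takeˢ s k)) (sym (ListP.take-map k (elems s))))

elems-dropˢ : ∀ {n} (S : Subset n) k → elems (dropˢ S k) ≡ drop k (elems S)
elems-dropˢ []          zero    = refl
elems-dropˢ []          (suc k) = refl
elems-dropˢ (false ∷ s) k       = trans (cong (map suc) (elems-dropˢ s k)) (sym (ListP.drop-map k (elems s)))
elems-dropˢ (true  ∷ s) zero    = cong (λ xs → 1 ∷ map suc xs) (elems-dropˢ s zero)
elems-dropˢ (true  ∷ s) (suc k) = trans (cong (map suc) (elems-dropˢ s k)) (sym (ListP.drop-map k (elems s)))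

∣takeˢ∣ : ∀ {n} (S : Subset n) k → ∣ takeˢ S k ∣ ≤ k
∣takeˢ∣ S k = begin
  ∣ takeˢ S k ∣                 ≡⟨ length-elems (takeˢ S k) ⟨
  length (elems (takeˢ S k))    ≡⟨ cong length (elems-takeˢ S k) ⟩
  length (take k (elems S))     ≡⟨ ListP.length-take k (elems S) ⟩
  k ℕ.⊓ length (elems S)        ≤⟨ ℕP.m⊓n≤m k _ ⟩
  k                             ∎
  where open ℕP.≤-Reasoning

∣dropˢ∣ : ∀ {n} (S : Subset n) k → ∣ dropˢ S k ∣ ≡ ∣ S ∣ ∸ k
∣dropˢ∣ S k = begin
  ∣ dropˢ S k ∣                 ≡⟨ length-elems (dropˢ S k) ⟨
  length (elems (dropˢ S k))    ≡⟨ cong length (elems-dropˢ S k) ⟩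
  length (drop k (elems S))     ≡⟨ ListP.length-drop k (elems S) ⟩
  length (elems S) ∸ k          ≡⟨ cong (_∸ k) (length-elems S) ⟩
  ∣ S ∣ ∸ k                     ∎
  where open ≡-Reasoning

∈takeˢ : ∀ {n} {x : Fin n} (S : Subset n) k → suc (toℕ x) ∈ₗ take k (elems S) → x ∈ takeˢ S k
∈takeˢ S k m = Equivalence.from ∈⇔∈elems (subst (_ ∈ₗ_) (sym (elems-takeˢ S k)) m)

∈dropˢ : ∀ {n} {x : Fin n} (S : Subset n) k → suc (toℕ x) ∈ₗ drop k (elems S) → x ∈ dropˢ S k
∈dropˢ S k m = Equivalence.from ∈⇔∈elems (subst (_ ∈ₗ_) (sym (elems-dropˢ S k)) m)

∈-take-or-drop : ∀ {n} {x : Fin n} {S} k → x ∈ S →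
                 suc (toℕ x) ∈ₗ take k (elems S) ⊎ suc (toℕ x) ∈ₗ drop k (elems S)
∈-take-or-drop {S = S} k x∈S =
  ∈-++⁻ (take k (elems S))
        (subst (_ ∈ₗ_) (sym (ListP.take++drop≡id k (elems S))) (Equivalence.to ∈⇔∈elems x∈S))

compatible-sym : ∀ {n} {a b : Arc n} → compatible a b → compatible b a
compatible-sym ((i≢i′ , i≢j′ , j≢i′ , j≢j′) , position) =
  (i≢i′ ∘ sym , j≢i′ ∘ sym , i≢j′ ∘ sym , j≢j′ ∘ sym) , Sum.map Sum.swap Sum.swap position

compatible-with-members : ∀ {n} {a : Arc n} M → AllPairs compatible M → a ∈ₗ M →
                          All (λ b → b ≡ a ⊎ compatible a b) M
compatible-with-members (b ∷ M) (c ∷ cs) (here refl) = inj₁ refl ∷ All.map inj₂ c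
compatible-with-members (b ∷ M) (c ∷ cs) (there a∈M) =
  inj₂ (compatible-sym (All.lookup c a∈M)) ∷ compatible-with-members M cs a∈M

compatible-disjoint : ∀ {n} {a b : Arc n} {x} → compatible a b → isEndpoint x a → ¬ isEndpoint x b
compatible-disjoint ((i≢i′ , i≢j′ , j≢i′ , j≢j′) , _) (inj₁ refl) (inj₁ refl) = i≢i′ refl
compatible-disjoint ((i≢i′ , i≢j′ , j≢i′ , j≢j′) , _) (inj₁ refl) (inj₂ refl) = i≢j′ refl
compatible-disjoint ((i≢i′ , i≢j′ , j≢i′ , j≢j′) , _) (inj₂ refl) (inj₁ refl) = j≢i′ refl
compatible-disjoint ((i≢i′ , i≢j′ , j≢i′ , j≢j′) , _) (inj₂ refl) (inj₂ refl) = j≢j′ refl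

Agree : ∀ {n} → Subset n → Subset n → Arc n → Set
Agree S S′ (i , j) = (i ∈ S ⇔ i ∈ S′) × (j ∈ S ⇔ j ∈ S′)

toggle-agree : ∀ {n} {x : Fin n} {S} {b} → ¬ isEndpoint x b → Agree (toggle x S) S b
toggle-agree x∉b = toggle-≢ (x∉b ∘ inj₁ ∘ sym) , toggle-≢ (x∉b ∘ inj₂ ∘ sym)

agree-trans : ∀ {n} {S S′ S″ : Subset n} {b} → Agree S S′ b → Agree S′ S″ b → Agree S S″ b
agree-trans (i⇔ , j⇔) (i⇔′ , j⇔′) = ⇔.trans i⇔ i⇔′ , ⇔.trans j⇔ j⇔′

exchange-agree : ∀ {n} {x y : Fin n} {S} {b} → compatible (x , y) b → Agree (exchange x y S) S b
exchange-agree c =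
  agree-trans (toggle-agree (compatible-disjoint c (inj₁ refl))) (toggle-agree (compatible-disjoint c (inj₂ refl)))

Meets : ∀ {n} → Subset n → Arc n → Set
Meets W (i , j) = i ∈ W ⊎ j ∈ W

meets? : ∀ {n} (W : Subset n) → Decidable (Meets W)
meets? W (i , j) = (i SubsetP.∈? W) ⊎-dec (j SubsetP.∈? W)

meets-endpoint : ∀ {n} {W : Subset n} {a} → Meets W a → ∃ λ x → x ∈ W × isEndpoint x a
meets-endpoint (inj₁ i∈W) = _ , i∈W , inj₁ refl
meets-endpoint (inj₂ j∈W) = _ , j∈W , inj₂ refl

SameSide : ∀ {n} → Subset n → Arc n → Set
SameSide I (i , j) = (i ∈ I × j ∈ I) ⊎ (i ∉ I × j ∉ I)

oneEndIn-agree : ∀ {n} {S S′ : Subset n} {b} → Agree S S′ b → oneEndIn S′ b → oneEndIn S b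
oneEndIn-agree (i⇔ , j⇔) (inj₁ (i∈ , j∉)) = inj₁ (Equivalence.from i⇔ i∈ , j∉ ∘ Equivalence.to j⇔)
oneEndIn-agree (i⇔ , j⇔) (inj₂ (i∉ , j∈)) = inj₂ (i∉ ∘ Equivalence.to i⇔ , Equivalence.from j⇔ j∈)

meets-agree : ∀ {n} {S S′ : Subset n} {b} → Agree S S′ b → Meets S′ b → Meets S b
meets-agree (i⇔ , j⇔) = Sum.map (Equivalence.from i⇔) (Equivalence.from j⇔)

sameSide-agree : ∀ {n} {S S′ : Subset n} {b} → Agree S S′ b → SameSide S′ b → SameSide S b
sameSide-agree (i⇔ , j⇔) (inj₁ (i∈ , j∈)) = inj₁ (Equivalence.from i⇔ i∈ , Equivalence.from j⇔ j∈)
sameSide-agree (i⇔ , j⇔) (inj₂ (i∉ , j∉)) = inj₂ (i∉ ∘ Equivalence.to i⇔ , j∉ ∘ Equivalence.to j⇔)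

-- Arcs with pairwise distinct endpoints, each meeting W, number at most ∣ W ∣:
-- each arc uses up a point of W of its own.
hitting-bound : ∀ {n} (W : Subset n) M → AllPairs compatible M → All (Meets W) M → length M ≤ ∣ W ∣
hitting-bound W []      []       []          = z≤n
hitting-bound W (a ∷ M) (c ∷ cs) (meet ∷ ms) with x , x∈W , x-end ← meets-endpoint meet =
  subst (suc (length M) ≤_) (∣toggle∣-∈ x∈W)
    (s≤s (hitting-bound (toggle x W) M cs
           (All.zipWith (λ (cb , mb) → meets-agree (toggle-agree (compatible-disjoint cb x-end)) mb) (c , ms))))

endpoint-of-rest : ∀ {n} {k : Fin n} {a M} → ¬ isEndpoint k a → Any (isEndpoint k) (a ∷ M) →
                   Any (isEndpoint k) M
endpoint-of-rest k∉a (here k∈a)  = ⊥-elim (k∉a k∈a)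
endpoint-of-rest k∉a (there k∈M) = k∈M

-- If every element of I is an endpoint of a matching none of whose arcs
-- straddles I, then I is paired off by arcs, so ∣ I ∣ is even.
even-cover : ∀ {n} (I : Subset n) M → AllPairs compatible M → All isArc M → All (SameSide I) M →
             (∀ k → k ∈ I → Any (isEndpoint k) M) → ∃ λ m → ∣ I ∣ ≡ m * 2
even-cover {n} I [] [] [] [] covered =
  0 , trans (cong ∣_∣ (SubsetP.Empty-unique (λ (k , k∈I) → uncovered (covered k k∈I))))
            (SubsetP.∣⊥∣≡0 n)
  where
  uncovered : ∀ {k} → ¬ Any (isEndpoint k) []
  uncovered ()
even-cover I ((i , j) ∷ M) (c ∷ cs) (_ ∷ arcs) (inj₂ (i∉ , j∉) ∷ sides) covered =
  even-cover I M cs arcs sides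
    (λ k k∈I → endpoint-of-rest [ (λ { refl → i∉ k∈I }) , (λ { refl → j∉ k∈I }) ] (covered k k∈I))
even-cover I ((i , j) ∷ M) (c ∷ cs) (i<j ∷ arcs) (inj₁ (i∈ , j∈) ∷ sides) covered
  = pair-off (even-cover I′ M cs arcs
               (All.zipWith (λ (cb , sb) → sameSide-agree (exchange-agree cb) sb) (c , sides))
               (λ k k∈I′ → endpoint-of-rest [ ≢i k∈I′ , ≢j k∈I′ ] (covered k (I′⊆I k∈I′))))
  where
  I′ : Subset _
  I′ = exchange i j I
  i≢j : i ≢ j
  i≢j = FinP.<⇒≢ i<j
  i∈toggle-j : i ∈ toggle j I
  i∈toggle-j = Equivalence.from (toggle-≢ i≢j) i∈
  ≢i : ∀ {k} → k ∈ I′ → k ≢ i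
  ≢i k∈I′ refl = toggle-∈ i∈toggle-j k∈I′
  ≢j : ∀ {k} → k ∈ I′ → k ≢ j
  ≢j k∈I′ refl = toggle-∈ j∈ (Equivalence.to (toggle-≢ (i≢j ∘ sym)) k∈I′)
  I′⊆I : I′ ⊆ I
  I′⊆I k∈I′ = Equivalence.to (exchange-≢ (≢i k∈I′) (≢j k∈I′)) k∈I′
  ∣I∣≡ : suc (suc ∣ I′ ∣) ≡ ∣ I ∣
  ∣I∣≡ = trans (cong suc (∣toggle∣-∈ i∈toggle-j)) (∣toggle∣-∈ j∈)
  pair-off : (∃ λ m → ∣ I′ ∣ ≡ m * 2) → ∃ λ m → ∣ I ∣ ≡ m * 2
  pair-off (m , ∣I′∣≡) = suc m , trans (sym ∣I∣≡) (cong (λ s → suc (suc s)) ∣I′∣≡)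

compatible⇒sameSide : ∀ {n} {I : Subset n} {u v i j : Fin n} →
                      (∀ k → k ∈ I ⇔ inInterval k (u , v)) → compatible (u , v) (i , j) → isArc (i , j) →
                      SameSide I (i , j)
compatible⇒sameSide {I = I} {u} {v} {i} {j} I⇔ ((u≢i , _ , _ , v≢j) , position) i<j = side position
  where
  within : ∀ {k} → u Fin.≤ k → k Fin.≤ v → k ∈ I
  within u≤k k≤v = Equivalence.from (I⇔ _) (u≤k , k≤v)
  left : ∀ {k} → k Fin.< u → k ∉ I
  left k<u k∈I = ℕP.<⇒≱ k<u (proj₁ (Equivalence.to (I⇔ _) k∈I))
  right : ∀ {k} → v Fin.< k → k ∉ I
  right v<k k∈I = ℕP.<⇒≱ v<k (proj₂ (Equivalence.to (I⇔ _) k∈I))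
  side : (v Fin.< i ⊎ j Fin.< u) ⊎ ((u Fin.≤ i × j Fin.≤ v) ⊎ (i Fin.≤ u × v Fin.≤ j)) →
         SameSide I (i , j)
  side (inj₁ (inj₁ v<i))         = inj₂ (right v<i , right (FinP.<-trans v<i i<j))
  side (inj₁ (inj₂ j<u))         = inj₂ (left (FinP.<-trans i<j j<u) , left j<u)
  side (inj₂ (inj₁ (u≤i , j≤v))) =
    inj₁ (within u≤i (ℕP.≤-trans (ℕP.<⇒≤ i<j) j≤v) , within (ℕP.≤-trans u≤i (ℕP.<⇒≤ i<j)) j≤v)
  side (inj₂ (inj₂ (i≤u , v≤j))) =
    inj₂ (left (FinP.≤∧≢⇒< i≤u (u≢i ∘ sym)) , right (FinP.≤∧≢⇒< v≤j v≢j))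

block : (n : ℕ) → ℕ → ℕ → Subset n
block zero    a       ℓ       = []
block (suc n) zero    zero    = outside ∷ block n zero zero
block (suc n) zero    (suc ℓ) = inside  ∷ block n zero ℓ
block (suc n) (suc a) ℓ       = outside ∷ block n a ℓ

∈block⇔ : ∀ {n} a ℓ (k : Fin n) → k ∈ block n a ℓ ⇔ (a ≤ toℕ k × toℕ k < a + ℓ)
∈block⇔ a ℓ k = mk⇔ (to a ℓ k) (from a ℓ k)
  where
  to : ∀ {n} a ℓ (k : Fin n) → k ∈ block n a ℓ → a ≤ toℕ k × toℕ k < a + ℓ
  to zero    zero    (suc k) (there k∈) with () ← proj₂ (to zero zero k k∈)
  to zero    (suc ℓ) zero    here       = z≤n , s≤s z≤n
  to zero    (suc ℓ) (suc k) (there k∈) = z≤n , s≤s (proj₂ (to zero ℓ k k∈))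
  to (suc a) ℓ       (suc k) (there k∈) = Product.map s≤s s≤s (to a ℓ k k∈)
  from : ∀ {n} a ℓ (k : Fin n) → a ≤ toℕ k × toℕ k < a + ℓ → k ∈ block n a ℓ
  from zero    (suc ℓ) zero    _                   = here
  from zero    (suc ℓ) (suc k) (_ , s≤s k<ℓ)       = there (from zero ℓ k (z≤n , k<ℓ))
  from (suc a) ℓ       (suc k) (s≤s a≤k , s≤s k<) = there (from a ℓ k (a≤k , k<))

∣block∣ : ∀ n a ℓ → a + ℓ ≤ n → ∣ block n a ℓ ∣ ≡ ℓ
∣block∣ zero    zero    zero    _         = refl
∣block∣ (suc n) zero    zero    _         = ∣block∣ n zero zero z≤n
∣block∣ (suc n) zero    (suc ℓ) (s≤s ℓ≤n) = cong suc (∣block∣ n zero ℓ ℓ≤n)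
∣block∣ (suc n) (suc a) ℓ       (s≤s a+ℓ≤n) = ∣block∣ n a ℓ a+ℓ≤n

-- In a matching covering every point under its arcs, each arc (u , v) spans an
-- even number of points [u..v], so v − u is odd.
arc-odd : ∀ {n} (M : List (Arc n)) {u v : Fin n} → (u , v) ∈ₗ M →
          AllPairs compatible M → All isArc M → (∀ k → Any (inInterval k) M → Any (isEndpoint k) M) →
          ∃ λ m → toℕ v ≡ toℕ u + suc (m * 2)
arc-odd {n} M {u} {v} uv∈M pairs arcs closed =
  odd-span (even-cover I M pairs arcs sides covered)
  where
  u≤v : toℕ u ≤ toℕ v
  u≤v = ℕP.<⇒≤ (All.lookup arcs uv∈M)
  span : ℕ
  span = toℕ v ∸ toℕ u
  end : toℕ u + suc span ≡ suc (toℕ v)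
  end = trans (ℕP.+-suc (toℕ u) span) (cong suc (ℕP.m+[n∸m]≡n u≤v))
  I : Subset n
  I = block n (toℕ u) (suc span)
  I⇔ : ∀ k → k ∈ I ⇔ inInterval k (u , v)
  I⇔ k = ⇔.trans (∈block⇔ (toℕ u) (suc span) k)
                 (mk⇔ (Product.map₂ (λ k< → ℕP.≤-pred (subst (toℕ k <_) end k<)))
                      (Product.map₂ (λ k≤v → subst (toℕ k <_) (sym end) (s≤s k≤v))))
  sides : All (SameSide I) M
  sides = All.zipWith side (compatible-with-members M pairs uv∈M , arcs)
    where
    side : ∀ {b} → (b ≡ (u , v) ⊎ compatible (u , v) b) × isArc b → SameSide I b
    side (inj₁ refl , _)      = inj₁ (Equivalence.from (I⇔ u) (ℕP.≤-refl , u≤v) ,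
                                      Equivalence.from (I⇔ v) (u≤v , ℕP.≤-refl))
    side (inj₂ c    , b-arc) = compatible⇒sameSide I⇔ c b-arc
  covered : ∀ k → k ∈ I → Any (isEndpoint k) M
  covered k k∈I = closed k (Any.map (λ { refl → Equivalence.to (I⇔ k) k∈I }) uv∈M)
  ∣I∣≡ : ∣ I ∣ ≡ suc span
  ∣I∣≡ = ∣block∣ n (toℕ u) (suc span) (subst (_≤ n) (sym end) (FinP.toℕ<n v))
  odd-span : (∃ λ m → ∣ I ∣ ≡ m * 2) → ∃ λ m → toℕ v ≡ toℕ u + suc (m * 2)
  odd-span (zero  , ∣I∣≡0)  with () ← trans (sym ∣I∣≡) ∣I∣≡0
  odd-span (suc m , ∣I∣≡2m) =
    m , trans (sym (ℕP.m+[n∸m]≡n u≤v)) (cong (toℕ u +_) (ℕP.suc-injective (trans (sym ∣I∣≡) ∣I∣≡2m)))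

-- The blocked set: the first d − 1 elements of B and the elements of ∁ B after
-- its d-th one.  It contains B^left and every point outside C, and it is small.
blocked : ∀ {n} → Subset n → ℕ → Subset n
blocked B d = takeˢ B (d ∸ 1) ∪ dropˢ (∁ B) d

Bleft⊆blocked : ∀ {n} (B : Subset n) d → Bleft B d ⊆ blocked B d
Bleft⊆blocked B d x∈ =
  SubsetP.p⊆p∪q (dropˢ (∁ B) d)
    (∈takeˢ B (d ∸ 1) (Equivalence.to (∈⇔∈fromList (take (d ∸ 1) (elems B))) x∈))

-- A point of B not among b_d, …, b_p is among b_1, …, b_{d-1}; a point of ∁ B
-- not among b̄_1, …, b̄_d comes after b̄_d.
∉C⇒blocked : ∀ {n} (B : Subset n) d {x} → x ∉ Cset B d → x ∈ blocked B d
∉C⇒blocked B d {x} x∉C with x SubsetP.∈? B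
... | yes x∈B with ∈-take-or-drop (d ∸ 1) x∈B
...   | inj₁ early = SubsetP.p⊆p∪q (dropˢ (∁ B) d) (∈takeˢ B (d ∸ 1) early)
...   | inj₂ late  = ⊥-elim (x∉C (Equivalence.from (∈⇔∈fromList _) (∈-++⁺ʳ (take d (elems (∁ B))) late)))
∉C⇒blocked B d {x} x∉C | no x∉B with ∈-take-or-drop d (SubsetP.x∉p⇒x∈∁p x∉B)
...   | inj₁ early = ⊥-elim (x∉C (Equivalence.from (∈⇔∈fromList _) (∈-++⁺ˡ early)))
...   | inj₂ late  = SubsetP.q⊆p∪q (takeˢ B (d ∸ 1)) (dropˢ (∁ B) d) (∈dropˢ (∁ B) d late)

∣blocked∣ : ∀ {n} (B : Subset n) d → ∣ blocked B d ∣ ≤ (d ∸ 1) + (∣ ∁ B ∣ ∸ d)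
∣blocked∣ B d = ℕP.≤-trans (∣∪∣≤ (takeˢ B (d ∸ 1)) (dropˢ (∁ B) d))
                           (ℕP.+-mono-≤ (∣takeˢ∣ B (d ∸ 1)) (ℕP.≤-reflexive (∣dropˢ∣ (∁ B) d)))

-- For ∣ B ∣ = p and 1 ≤ d ≤ q:  ∣ blocked ∣ ≤ (d − 1) + (q − d) < q.
blocked-small : ∀ p q (B : Subset (p + q)) → ∣ B ∣ ≡ p →
                ∀ d → 1 ≤ d → d ≤ q → ∣ blocked B d ∣ < q
blocked-small p q B ∣B∣≡p (suc d) _ d<q =
  ℕP.≤-<-trans (∣blocked∣ B (suc d))
               (subst (λ c → d + (c ∸ suc d) < q) (sym ∣∁B∣≡q) (ℕP.≤-reflexive (ℕP.m+[n∸m]≡n d<q)))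
  where
  ∣∁B∣≡q : ∣ ∁ B ∣ ≡ q
  ∣∁B∣≡q = trans (SubsetP.∣∁p∣≡n∸∣p∣ B) (trans (cong (p + q ∸_) ∣B∣≡p) (ℕP.m+n∸m≡n p q))

no-feasible : ∀ p q {W : Subset (p + q)} {M} → ∣ W ∣ < q → All (Meets W) M → ∀ A → ¬ Feasible p q A M
no-feasible p q {W} {M} ∣W∣<q all-meet A (len , _ , pairs , _) =
  ℕP.<⇒≱ ∣W∣<q (subst (_≤ ∣ W ∣) len (hitting-bound W M pairs all-meet))

countFeasible-none : ∀ p q {𝒜 : Pred (Subset (p + q)) 0ℓ} (𝒜? : Decidable 𝒜) M →
                     (∀ A → ¬ Feasible p q A M) → countFeasible p q 𝒜? M ≡ 0
countFeasible-none p q 𝒜? M none = count-none (λ A → 𝒜? A ×-dec feasible? p q A M) (λ A → none A ∘ proj₂)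

exchange-ℬ : ∀ p {n} (B : Subset n) d {x y A} → x ∈ Cset B d → y ∈ Cset B d →
             x ∉ Bleft B d → y ∉ Bleft B d → oneEndIn A (x , y) → inℬ p B d A → inℬ p B d (exchange x y A)
exchange-ℬ p B d {x} {y} x∈C y∈C x∉L y∉L one (Z , Z⊆C , ∣Z∣≡ , refl) =
  exchange x y Z , Z′⊆C , trans (∣exchange∣ oneZ) ∣Z∣≡ , A′≡
  where
  L : Subset _
  L = Bleft B d
  A′≡ : exchange x y (L ∪ Z) ≡ L ∪ exchange x y Z
  A′≡ = trans (cong (toggle x) (toggle-∪ y L Z y∉L)) (toggle-∪ x L (toggle y Z) x∉L)
  agree : ∀ {k} → k ∉ L → k ∈ Z ⇔ k ∈ L ∪ Z
  agree k∉L = mk⇔ (SubsetP.q⊆p∪q L Z)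
                  (λ k∈ → [ ⊥-elim ∘ k∉L , (λ k∈Z → k∈Z) ] (SubsetP.x∈p∪q⁻ L Z k∈))
  oneZ : oneEndIn Z (x , y)
  oneZ = oneEndIn-agree (agree x∉L , agree y∉L) one
  Z′⊆C : exchange x y Z ⊆ Cset B d
  Z′⊆C {k} k∈ with k FinP.≟ x | k FinP.≟ y
  ... | yes refl | _        = x∈C
  ... | no _     | yes refl = y∈C
  ... | no k≢x   | no k≢y   = Z⊆C (Equivalence.to (exchange-≢ k≢x k≢y) k∈)

exchange-feasible : ∀ p q {A} {M} {x y} → (x , y) ∈ₗ M → Feasible p q A M → Feasible p q (exchange x y A) M
exchange-feasible p q {A} {M} {x} {y} xy∈M (len , arcs , pairs , ones , closed) =
  len , arcs , pairs , All.zipWith step (compatible-with-members M pairs xy∈M , ones) , closed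
  where
  step : ∀ {b} → (b ≡ (x , y) ⊎ compatible (x , y) b) × oneEndIn A b → oneEndIn (exchange x y A) b
  step (inj₁ refl , one) = exchange-oneEndIn one
  step (inj₂ c    , one) = oneEndIn-agree (exchange-agree c) one

-- If M has an arc (u , v) avoiding the blocked set, exchanging u and v is an
-- involution on the members of ℬ admitting M which flips the parity of Σ.
free-arc-balanced : ∀ p q (B : Subset (p + q)) d M {u v} → (u , v) ∈ₗ M →
                    u ∉ blocked B d → v ∉ blocked B d →
                    countFeasible p q (𝒜odd? p B d) M ≡ countFeasible p q (𝒜even? p B d) M
free-arc-balanced p q B d M {u} {v} uv∈M u-free v-free =
  count-exchange _ _ u v
    (λ A ((A∈ℬ , odd)  , F) → switch {Even} A A∈ℬ F (λ (_ , even⇔odd) → Equivalence.from even⇔odd odd))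
    (λ A ((A∈ℬ , even) , F) → switch {Odd}  A A∈ℬ F (λ (odd⇔even , _) → Equivalence.from odd⇔even even))
  where
  in-C : ∀ {x} → x ∉ blocked B d → x ∈ Cset B d
  in-C x-free = decidable-stable (_ SubsetP.∈? Cset B d) (x-free ∘ ∉C⇒blocked B d)
  off-Bleft : ∀ {x} → x ∉ blocked B d → x ∉ Bleft B d
  off-Bleft x-free = x-free ∘ Bleft⊆blocked B d
  switch : ∀ {Parity : ℕ → Set} A → inℬ p B d A → Feasible p q A M →
           (OppositeParity Σ[ exchange u v A ] Σ[ A ] → Parity Σ[ exchange u v A ]) →
           (inℬ p B d (exchange u v A) × Parity Σ[ exchange u v A ]) × Feasible p q (exchange u v A) M
  switch A A∈ℬ F@(_ , arcs , pairs , ones , closed) parity =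
    let one      = All.lookup ones uv∈M
        (m , v≡) = arc-odd M uv∈M pairs arcs closed
    in (exchange-ℬ p B d (in-C u-free) (in-C v-free) (off-Bleft u-free) (off-Bleft v-free) one A∈ℬ ,
        parity (exchange-parity m v≡ one)) ,
       exchange-feasible p q uv∈M F

-- Either every arc of M meets the (small) blocked set, and nothing admits M,
-- or some arc avoids it and the exchange involution balances the counts.
lemma6 : (p q : ℕ) → q ≤ p → 1 ≤ q →
         (B : Subset (p + q)) → ∣ B ∣ ≡ p →
         ¬ (elems B ≺ elems (∁ B)) → ¬ (elems (∁ B) ≺ elems B) →
         (d : ℕ) → 1 ≤ d → d ≤ q → nth (elems (∁ B)) d < nth (elems B) d →
         Balanced p q (𝒜odd? p B d) (𝒜even? p B d)
lemma6 p q _ _ B ∣B∣≡p _ _ d 1≤d d≤q _ M with All.all? (meets? (blocked B d)) M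
... | yes all-meet = trans (countFeasible-none p q (𝒜odd? p B d) M none)
                           (sym (countFeasible-none p q (𝒜even? p B d) M none))
  where
  none : ∀ A → ¬ Feasible p q A M
  none = no-feasible p q (blocked-small p q B ∣B∣≡p d 1≤d d≤q) all-meet
... | no some-free with (u , v) , uv∈M , free ← find (¬All⇒Any¬ (meets? (blocked B d)) M some-free) =
  free-arc-balanced p q B d M uv∈M (free ∘ inj₁) (free ∘ inj₂)
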